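{- Let $(a_n;n\geq 1)$ be a sequence of real numbers with $a_j\neq 0$ for all $j\geq 1$, and let $\varphi,g,h$ be power series with $\varphi(0)=0$ and $\varphi'(0)g(0)h(0)\neq 0$. Let $\mathcal{A}$ be the upper triangular matrix, indexed by $k,n\geq 1$, with entries \[ [\mathcal{A}]_{k,n}=\frac{a_k}{a_n}\frac{1}{k!}\left(\frac{d}{dt}\right)^{n-1}_{t=0}\left[(h(t))^n\frac{d}{dt}\left((\varphi(t))^k g(t)\right)\right]\quad (k\leq n), \] and $[\mathcal{A}]_{k,n}=0$ for $k>n$. Let $\omega$ be the power series with $\omega(0)=0$ satisfying $\omega(t)=t\,h(\omega(t))$. Then for every non-negative integer $s$, \[ [\mathcal{A}^{s}]_{k,n}=\frac{a_k}{a_n}\frac{1}{k!}\left(\frac{d}{dt}\right)^{n}_{t=0}\left[\left((\varphi\circ\omega)^{\langle s\rangle}(t)\right)^k\prod_{i=0}^{s-1} g\circ\omega\circ(\varphi\circ\omega)^{\langle i\rangle}(t)\right]. \]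
   Context: All power series are formal power series. $\left(\frac{d}{dt}\right)^{m}_{t=0}F$ denotes the $m$-th derivative of $F$ at $t=0$ ($m!$ times the coefficient of $t^m$). For a power series $\phi$ with $\phi(0)=0$: $\phi^{\langle 0\rangle}(t)=t$, $\phi^{\langle s\rangle}=\phi^{\langle s-1\rangle}\circ\phi$ for $s\geq1$. $\mathcal{A}^0=\mathcal{I}$ is the identity matrix; the empty product equals $1$. -}

module Defs where

open import Level using (Level; _⊔_) renaming (suc to lsuc)
open import Data.Nat using (ℕ; zero; suc; _≤ᵇ_; _≡ᵇ_; _∸_)
open import Data.Nat.Combinatorics using ()
open import Data.Nat using (_!)
open import Data.Bool using (if_then_else_)
open import Algebra.Bundles using (CommutativeRing)
open import Relation.Nullary using (¬_)

ringFromℕ : ∀ {c ℓ} (R : CommutativeRing c ℓ) → ℕ → CommutativeRing.Carrier R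
ringFromℕ R zero    = CommutativeRing.0# R
ringFromℕ R (suc n) = CommutativeRing._+_ R (CommutativeRing.1# R) (ringFromℕ R n)

-- A field of characteristic zero (the real numbers are one).
-- The inverse is a total function, specified only on non-zero elements.
record Char0Field (c ℓ : Level) : Set (lsuc (c ⊔ ℓ)) where
  field
    cring : CommutativeRing c ℓ
  open CommutativeRing cring public
  field
    _⁻¹      : Carrier → Carrier
    inverseʳ : ∀ x → ¬ (x ≈ 0#) → (x * (x ⁻¹)) ≈ 1#
    char0    : ∀ n → ¬ (ringFromℕ cring (suc n) ≈ 0#)

  fromℕ : ℕ → Carrier
  fromℕ = ringFromℕ cring

module Series {c ℓ : Level} (F : Char0Field c ℓ) where
  open Char0Field F using (Carrier; _+_; _*_; 0#; 1#; _⁻¹; fromℕ)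

  PS : Set c
  PS = ℕ → Carrier

  sumTo : ℕ → (ℕ → Carrier) → Carrier
  sumTo zero    f = f zero
  sumTo (suc n) f = sumTo n f + f (suc n)

  sum1To : ℕ → (ℕ → Carrier) → Carrier
  sum1To zero    f = 0#
  sum1To (suc n) f = sum1To n f + f (suc n)

  one : PS
  one zero    = 1#
  one (suc _) = 0#

  X : PS
  X n = if n ≡ᵇ 1 then 1# else 0#

  mul : PS → PS → PS
  mul f g n = sumTo n (λ i → f i * g (n ∸ i))

  pow : PS → ℕ → PS
  pow f zero    = one
  pow f (suc k) = mul (pow f k) f

  -- composition f ∘ φ (meaningful for φ(0) = 0)
  comp : PS → PS → PS
  comp f φ n = sumTo n (λ j → f j * pow φ j n)

  deriv : PS → PS
  deriv f n = fromℕ (suc n) * f (suc n)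

  dAt : ℕ → PS → Carrier
  dAt m f = fromℕ (m !) * f m

  iter : PS → ℕ → PS
  iter φ zero    = X
  iter φ (suc s) = comp (iter φ s) φ

  prodS : ℕ → (ℕ → PS) → PS
  prodS zero    G = one
  prodS (suc s) G = mul (prodS s G) (G s)

  -- matrices indexed by k, n ≥ 1 (entries at index 0 are unused)
  Mat : Set c
  Mat = ℕ → ℕ → Carrier

  idMat : Mat
  idMat k n = if k ≡ᵇ n then 1# else 0#

  -- product with an upper triangular right factor B:
  -- [A B]_{k,n} = Σ_{j=1}^{n} A_{k,j} B_{j,n}
  _·_ : Mat → Mat → Mat
  (A · B) k n = sum1To n (λ j → A k j * B j n)

  matPow : Mat → ℕ → Mat
  matPow A zero    = idMat
  matPow A (suc s) = A · matPow A s

  𝒜 : (ℕ → Carrier) → PS → PS → PS → Mat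
  𝒜 a φ g h k n =
    if k ≤ᵇ n
    then a k * (a n) ⁻¹ * (fromℕ (k !)) ⁻¹
           * dAt (n ∸ 1) (mul (pow h n) (deriv (mul (pow φ k) g)))
    else 0#

-- Put ψ = φ ∘ ω. Lagrange inversion for ω = t h(ω), in the form n [tⁿ] ωᵐ = m [tⁿ⁻ᵐ] hⁿ, is proved
-- coefficientwise by strong induction on n using the Euler operator t d/dt; it yields the
-- Lagrange–Bürmann formula n [tⁿ] (F ∘ ω) = [tⁿ⁻¹] hⁿ F′. Applied to F = φᵏ g it shows that
-- [𝒜]ₖₙ = (aₖ / aₙ) (1 / k!) n! [tⁿ] ψᵏ (g ∘ ω), so that, up to the diagonal scaling, 𝒜 is the matrix
-- of the weighted substitution F ↦ (F ∘ ψ) · (g ∘ ω). Induction on s then computes 𝒜ˢ, since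
-- Σⱼ [tʲ] C · [tⁿ] (χʲ P) = [tⁿ] ((C ∘ χ) P) and ψ ∘ ψ^⟨s⟩ = ψ^⟨s+1⟩.
module Submission where

open import Level using (Level)
open import Data.Bool using (if_then_else_)
open import Data.Nat as ℕ using (ℕ; zero; suc; _≤_; _<_; _∸_; _!; z≤n; s≤s; NonZero)
import Data.Nat.Properties as ℕₚ
open import Data.Nat.Induction using (<-rec)
open import Data.Product using (_,_)
open import Relation.Binary.PropositionalEquality as ≡ using (_≡_; _≢_)
open import Relation.Nullary using (¬_; yes; no; contradiction)
open import Relation.Nullary.Reflects using (Reflects; ofʸ; ofⁿ; fromEquivalence)
open import Defs

≡ᵇ-reflects-≡ : ∀ m n → Reflects (m ≡ n) (m ℕ.≡ᵇ n)
≡ᵇ-reflects-≡ m n = fromEquivalence (ℕₚ.≡ᵇ⇒≡ m n) (ℕₚ.≡⇒≡ᵇ m n)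

module _ {c ℓ : Level} (F : Char0Field c ℓ) where
  open Char0Field F hiding (zero)
  open Series F
  open import Algebra.Properties.CommutativeSemigroup *-commutativeSemigroup
  open import Algebra.Properties.CommutativeSemigroup +-commutativeSemigroup
    using () renaming (interchange to +-interchange)
  open import Relation.Binary.Reasoning.Setoid setoid

  sumTo-cong : ∀ n {f g : ℕ → Carrier} → (∀ i → i ≤ n → f i ≈ g i) → sumTo n f ≈ sumTo n g
  sumTo-cong zero    f≈g = f≈g 0 z≤n
  sumTo-cong (suc n) f≈g =
    +-cong (sumTo-cong n (λ i i≤n → f≈g i (ℕₚ.m≤n⇒m≤1+n i≤n))) (f≈g (suc n) ℕₚ.≤-refl)

  sumTo-≈0 : ∀ n {f : ℕ → Carrier} → (∀ i → i ≤ n → f i ≈ 0#) → sumTo n f ≈ 0#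
  sumTo-≈0 zero    f≈0 = f≈0 0 z≤n
  sumTo-≈0 (suc n) f≈0 = trans
    (+-cong (sumTo-≈0 n (λ i i≤n → f≈0 i (ℕₚ.m≤n⇒m≤1+n i≤n))) (f≈0 (suc n) ℕₚ.≤-refl))
    (+-identityʳ 0#)

  sumTo-+ : ∀ n (f g : ℕ → Carrier) → sumTo n (λ i → f i + g i) ≈ sumTo n f + sumTo n g
  sumTo-+ zero    f g = refl
  sumTo-+ (suc n) f g = trans (+-congʳ (sumTo-+ n f g)) (+-interchange _ _ _ _)

  *-distribˡ-sumTo : ∀ n x (f : ℕ → Carrier) → x * sumTo n f ≈ sumTo n (λ i → x * f i)
  *-distribˡ-sumTo zero    x f = refl
  *-distribˡ-sumTo (suc n) x f = trans (distribˡ _ _ _) (+-congʳ (*-distribˡ-sumTo n x f))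

  *-distribʳ-sumTo : ∀ n x (f : ℕ → Carrier) → sumTo n f * x ≈ sumTo n (λ i → f i * x)
  *-distribʳ-sumTo zero    x f = refl
  *-distribʳ-sumTo (suc n) x f = trans (distribʳ _ _ _) (+-congʳ (*-distribʳ-sumTo n x f))

  sumTo-swap : ∀ m n (T : ℕ → ℕ → Carrier) →
               sumTo m (λ i → sumTo n (T i)) ≈ sumTo n (λ j → sumTo m (λ i → T i j))
  sumTo-swap zero    n T = refl
  sumTo-swap (suc m) n T =
    trans (+-congʳ (sumTo-swap m n T)) (sym (sumTo-+ n (λ j → sumTo m (λ i → T i j)) (T (suc m))))

  sumTo-head : ∀ n (f : ℕ → Carrier) → sumTo (suc n) f ≈ f 0 + sumTo n (λ i → f (suc i))
  sumTo-head zero    f = refl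
  sumTo-head (suc n) f = trans (+-congʳ (sumTo-head n f)) (+-assoc _ _ _)

  sumTo-reverse : ∀ n (f : ℕ → Carrier) → sumTo n (λ i → f (n ∸ i)) ≈ sumTo n f
  sumTo-reverse zero    f = refl
  sumTo-reverse (suc n) f =
    trans (sumTo-head n (λ i → f (suc n ∸ i))) (trans (+-congˡ (sumTo-reverse n f)) (+-comm _ _))

  sumTo-tail : ∀ {n N} {f : ℕ → Carrier} → n ≤ N → (∀ i → n < i → i ≤ N → f i ≈ 0#) →
               sumTo N f ≈ sumTo n f
  sumTo-tail {n} {zero}  z≤n _ = refl
  sumTo-tail {n} {suc N} n≤1+N f≈0 with n ℕ.≟ suc N
  ... | yes ≡.refl = refl
  ... | no n≢1+N   = trans
    (+-cong (sumTo-tail n≤N (λ i n<i i≤N → f≈0 i n<i (ℕₚ.m≤n⇒m≤1+n i≤N))) (f≈0 (suc N) (s≤s n≤N) ℕₚ.≤-refl))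
    (+-identityʳ _)
    where n≤N = ℕₚ.≤-pred (ℕₚ.≤∧≢⇒< n≤1+N n≢1+N)

  sumTo-single : ∀ {N} t {f : ℕ → Carrier} → t ≤ N → (∀ i → i ≤ N → i ≢ t → f i ≈ 0#) →
                 sumTo N f ≈ f t
  sumTo-single {zero}  _ z≤n _ = refl
  sumTo-single {suc N} t t≤1+N f≈0 with t ℕ.≟ suc N
  ... | yes ≡.refl = trans
    (+-congʳ (sumTo-≈0 N (λ i i≤N → f≈0 i (ℕₚ.m≤n⇒m≤1+n i≤N) (λ { ≡.refl → ℕₚ.1+n≰n i≤N }))))
    (+-identityˡ _)
  ... | no t≢1+N = trans
    (+-cong (sumTo-single t t≤N (λ i i≤N → f≈0 i (ℕₚ.m≤n⇒m≤1+n i≤N)))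
            (f≈0 (suc N) ℕₚ.≤-refl (λ eq → t≢1+N (≡.sym eq))))
    (+-identityʳ _)
    where t≤N = ℕₚ.≤-pred (ℕₚ.≤∧≢⇒< t≤1+N t≢1+N)

  sumTo-triangle : ∀ n (T : ℕ → ℕ → Carrier) →
                   sumTo n (λ m → sumTo m (λ i → T i m))
                   ≈ sumTo n (λ i → sumTo (n ∸ i) (λ j → T i (i ℕ.+ j)))
  sumTo-triangle zero    T = refl
  sumTo-triangle (suc n) T = begin
      sumTo n (λ m → sumTo m (λ i → T i m)) + sumTo (suc n) (λ i → T i (suc n))
    ≈⟨ trans (+-congʳ (sumTo-triangle n T)) (sym (+-assoc _ _ _)) ⟩
      (sumTo n (λ i → sumTo (n ∸ i) (λ j → T i (i ℕ.+ j))) + sumTo n (λ i → T i (suc n)))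
        + T (suc n) (suc n)
    ≈⟨ +-cong (trans (sym (sumTo-+ n _ _)) (sumTo-cong n column)) (reflexive last) ⟩
      sumTo n (λ i → sumTo (suc n ∸ i) (λ j → T i (i ℕ.+ j)))
        + sumTo (n ∸ n) (λ j → T (suc n) (suc n ℕ.+ j)) ∎
    where
    column : ∀ i → i ≤ n →
             sumTo (n ∸ i) (λ j → T i (i ℕ.+ j)) + T i (suc n) ≈ sumTo (suc n ∸ i) (λ j → T i (i ℕ.+ j))
    column i i≤n rewrite ℕₚ.+-∸-assoc 1 i≤n =
      +-congˡ (reflexive (≡.cong (T i) (≡.trans (≡.sym (ℕₚ.m+[n∸m]≡n (ℕₚ.m≤n⇒m≤1+n i≤n)))
                                                 (≡.cong (i ℕ.+_) (ℕₚ.+-∸-assoc 1 i≤n)))))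
    last : T (suc n) (suc n) ≡ sumTo (n ∸ n) (λ j → T (suc n) (suc n ℕ.+ j))
    last rewrite ℕₚ.n∸n≡0 n = ≡.cong (T (suc n)) (≡.sym (ℕₚ.+-identityʳ (suc n)))

  sumTo-sum1To : ∀ n (f : ℕ → Carrier) → sumTo n f ≈ f 0 + sum1To n f
  sumTo-sum1To zero    f = sym (+-identityʳ _)
  sumTo-sum1To (suc n) f = trans (+-congʳ (sumTo-sum1To n f)) (+-assoc _ _ _)

  sum1To-cong : ∀ n {f g : ℕ → Carrier} → (∀ i → 1 ≤ i → i ≤ n → f i ≈ g i) → sum1To n f ≈ sum1To n g
  sum1To-cong zero    f≈g = refl
  sum1To-cong (suc n) f≈g =
    +-cong (sum1To-cong n (λ i 1≤i i≤n → f≈g i 1≤i (ℕₚ.m≤n⇒m≤1+n i≤n))) (f≈g (suc n) (s≤s z≤n) ℕₚ.≤-refl)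

  *-distribˡ-sum1To : ∀ n x (f : ℕ → Carrier) → x * sum1To n f ≈ sum1To n (λ i → x * f i)
  *-distribˡ-sum1To zero    x f = zeroʳ x
  *-distribˡ-sum1To (suc n) x f = trans (distribˡ _ _ _) (+-congʳ (*-distribˡ-sum1To n x f))

  infix 4 _≋_
  _≋_ : PS → PS → Set ℓ
  f ≋ g = ∀ n → f n ≈ g n

  mul-cong-≤ : ∀ n {f f′ g g′ : PS} → (∀ i → i ≤ n → f i ≈ f′ i) → (∀ i → i ≤ n → g i ≈ g′ i) →
               mul f g n ≈ mul f′ g′ n
  mul-cong-≤ n f≈f′ g≈g′ = sumTo-cong n (λ i i≤n → *-cong (f≈f′ i i≤n) (g≈g′ (n ∸ i) (ℕₚ.m∸n≤m n i)))

  mul-cong : ∀ {f f′ g g′ : PS} → f ≋ f′ → g ≋ g′ → mul f g ≋ mul f′ g′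
  mul-cong f≈f′ g≈g′ n = mul-cong-≤ n (λ i _ → f≈f′ i) (λ i _ → g≈g′ i)

  mul-congˡ : ∀ f {g g′ : PS} → g ≋ g′ → mul f g ≋ mul f g′
  mul-congˡ f = mul-cong {f} (λ _ → refl)

  mul-congʳ : ∀ {f f′ : PS} g → f ≋ f′ → mul f g ≋ mul f′ g
  mul-congʳ g f≈f′ = mul-cong {g = g} {g} f≈f′ (λ _ → refl)

  mul-comm : ∀ f g → mul f g ≋ mul g f
  mul-comm f g n = trans (sym (sumTo-reverse n (λ i → f i * g (n ∸ i))))
    (sumTo-cong n (λ i i≤n → trans (*-comm _ _) (*-congʳ (reflexive (≡.cong g (ℕₚ.m∸[m∸n]≡n i≤n))))))

  one-≢0 : ∀ {m} → m ≢ 0 → one m ≈ 0#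
  one-≢0 {zero}  m≢0 = contradiction ≡.refl m≢0
  one-≢0 {suc m} _   = refl

  mul-identityʳ : ∀ f → mul f one ≋ f
  mul-identityʳ f n = trans
    (sumTo-single n ℕₚ.≤-refl (λ i i≤n i≢n → trans (*-congˡ (one-≢0 (n∸i≢0 i≤n i≢n))) (zeroʳ _)))
    (trans (*-congˡ (reflexive (≡.cong one (ℕₚ.n∸n≡0 n)))) (*-identityʳ _))
    where
    n∸i≢0 : ∀ {i} → i ≤ n → i ≢ n → n ∸ i ≢ 0
    n∸i≢0 i≤n i≢n n∸i≡0 = i≢n (ℕₚ.≤-antisym i≤n (ℕₚ.m∸n≡0⇒m≤n n∸i≡0))

  mul-identityˡ : ∀ f → mul one f ≋ f
  mul-identityˡ f n = trans (mul-comm one f n) (mul-identityʳ f n)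

  mul-sumTo : ∀ n (f g u : PS) →
              sumTo n (λ m → mul f g m * u m) ≈ sumTo n (λ i → f i * sumTo (n ∸ i) (λ j → g j * u (i ℕ.+ j)))
  mul-sumTo n f g u = begin
      sumTo n (λ m → mul f g m * u m)
    ≈⟨ sumTo-cong n (λ m _ → *-distribʳ-sumTo m (u m) _) ⟩
      sumTo n (λ m → sumTo m (λ i → f i * g (m ∸ i) * u m))
    ≈⟨ sumTo-triangle n _ ⟩
      sumTo n (λ i → sumTo (n ∸ i) (λ j → f i * g (i ℕ.+ j ∸ i) * u (i ℕ.+ j)))
    ≈⟨ sumTo-cong n (λ i _ → trans (sumTo-cong (n ∸ i) (λ j _ → trans (*-assoc _ _ _)
         (*-congˡ (*-congʳ (reflexive (≡.cong g (ℕₚ.m+n∸m≡n i j)))))))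
         (sym (*-distribˡ-sumTo (n ∸ i) (f i) _))) ⟩
      sumTo n (λ i → f i * sumTo (n ∸ i) (λ j → g j * u (i ℕ.+ j))) ∎

  mul-assoc : ∀ f g h → mul (mul f g) h ≋ mul f (mul g h)
  mul-assoc f g h n = trans (mul-sumTo n f g (λ m → h (n ∸ m)))
    (sumTo-cong n (λ i _ → *-congˡ (sumTo-cong (n ∸ i) (λ j _ →
      *-congˡ (reflexive (≡.cong h (≡.sym (ℕₚ.∸-+-assoc n i j))))))))

  mul-interchange : ∀ f g u v → mul (mul f g) (mul u v) ≋ mul (mul f u) (mul g v)
  mul-interchange f g u v n = begin
      mul (mul f g) (mul u v) n ≈⟨ mul-assoc f g (mul u v) n ⟩
      mul f (mul g (mul u v)) n ≈⟨ mul-congˡ f (λ m → sym (mul-assoc g u v m)) n ⟩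
      mul f (mul (mul g u) v) n ≈⟨ mul-congˡ f (mul-congʳ v (mul-comm g u)) n ⟩
      mul f (mul (mul u g) v) n ≈⟨ mul-congˡ f (mul-assoc u g v) n ⟩
      mul f (mul u (mul g v)) n ≈⟨ sym (mul-assoc f u (mul g v) n) ⟩
      mul (mul f u) (mul g v) n ∎

  mul-scaleˡ : ∀ x (f g : PS) n → mul (λ m → x * f m) g n ≈ x * mul f g n
  mul-scaleˡ x f g n = trans (sumTo-cong n (λ i _ → *-assoc _ _ _)) (sym (*-distribˡ-sumTo n x _))

  mul-vanish : ∀ n (f g : PS) → (∀ i → i ≤ n → f i ≈ 0#) → mul f g n ≈ 0#
  mul-vanish n f g f≈0 = sumTo-≈0 n (λ i i≤n → trans (*-congʳ (f≈0 i i≤n)) (zeroˡ _))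

  pow-cong : ∀ {f g} → f ≋ g → ∀ k → pow f k ≋ pow g k
  pow-cong f≈g zero    n = refl
  pow-cong f≈g (suc k)   = mul-cong (pow-cong f≈g k) f≈g

  pow-+ : ∀ f i j → pow f (i ℕ.+ j) ≋ mul (pow f i) (pow f j)
  pow-+ f zero    j n = sym (mul-identityˡ (pow f j) n)
  pow-+ f (suc i) j n = begin
      mul (pow f (i ℕ.+ j)) f n         ≈⟨ mul-congʳ f (pow-+ f i j) n ⟩
      mul (mul (pow f i) (pow f j)) f n ≈⟨ mul-assoc (pow f i) (pow f j) f n ⟩
      mul (pow f i) (mul (pow f j) f) n ≈⟨ mul-congˡ (pow f i) (mul-comm (pow f j) f) n ⟩
      mul (pow f i) (mul f (pow f j)) n ≈⟨ sym (mul-assoc (pow f i) f (pow f j) n) ⟩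
      mul (mul (pow f i) f) (pow f j) n ∎

  pow-mul : ∀ f g k → pow (mul f g) k ≋ mul (pow f k) (pow g k)
  pow-mul f g zero    n = sym (mul-identityˡ one n)
  pow-mul f g (suc k) n =
    trans (mul-congʳ (mul f g) (pow-mul f g k) n) (mul-interchange (pow f k) (pow g k) f g n)

  pow-vanish : ∀ {f} → f 0 ≈ 0# → ∀ {k n} → n < k → pow f k n ≈ 0#
  pow-vanish {f} f0≈0 {suc k} {n} (s≤s n≤k) = sumTo-≈0 n term
    where
    term : ∀ i → i ≤ n → pow f k i * f (n ∸ i) ≈ 0#
    term i i≤n with i ℕ.<? k
    ... | yes i<k = trans (*-congʳ (pow-vanish f0≈0 i<k)) (zeroˡ _)
    ... | no  i≮k = trans (*-congˡ (trans (reflexive (≡.cong f n∸i≡0)) f0≈0)) (zeroʳ _)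
      where n∸i≡0 = ℕₚ.m≤n⇒m∸n≡0 (ℕₚ.≤-trans n≤k (ℕₚ.≮⇒≥ i≮k))

  X-≢1 : ∀ {n} → n ≢ 1 → X n ≈ 0#
  X-≢1 {zero}        _   = refl
  X-≢1 {suc zero}    n≢1 = contradiction ≡.refl n≢1
  X-≢1 {suc (suc n)} _   = refl

  mul-X : ∀ f n → mul f X (suc n) ≈ f n
  mul-X f n = trans (sumTo-single n (ℕₚ.n≤1+n n) (λ i i≤1+n i≢n →
                       trans (*-congˡ (X-≢1 (λ 1+n∸i≡1 → i≢n (i≡n i≤1+n 1+n∸i≡1)))) (zeroʳ _)))
                    (trans (*-congˡ (reflexive (≡.cong X (ℕₚ.m+n∸n≡m 1 n)))) (*-identityʳ _))
    where
    i≡n : ∀ {i} → i ≤ suc n → suc n ∸ i ≡ 1 → i ≡ n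
    i≡n {i} i≤1+n eq = ℕₚ.suc-injective
      (≡.trans (ℕₚ.+-comm 1 i) (≡.trans (≡.cong (i ℕ.+_) (≡.sym eq)) (ℕₚ.m+[n∸m]≡n i≤1+n)))

  pow-X : ∀ k → pow X k ≋ idMat k
  pow-X zero    zero    = refl
  pow-X zero    (suc n) = refl
  pow-X (suc k) zero    = zeroʳ _
  pow-X (suc k) (suc n) = trans (mul-X (pow X k) n) (pow-X k n)

  mul-pow-X : ∀ m r f → mul (pow X m) f (m ℕ.+ r) ≈ f r
  mul-pow-X m r f = trans (mul-comm (pow X m) f (m ℕ.+ r)) (shift m)
    where
    shift : ∀ m → mul f (pow X m) (m ℕ.+ r) ≈ f r
    shift zero    = mul-identityʳ f r
    shift (suc m) = trans (sym (mul-assoc f (pow X m) X (suc (m ℕ.+ r))))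
                          (trans (mul-X _ (m ℕ.+ r)) (shift m))

  if-reflects : ∀ {p} {P : Set p} {b x y z} → Reflects P b → (P → x ≈ z) → (¬ P → y ≈ z) →
                (if b then x else y) ≈ z
  if-reflects (ofʸ p)  x≈z _   = x≈z p
  if-reflects (ofⁿ ¬p) _   y≈z = y≈z ¬p

  idMat-diagonal : ∀ n → idMat n n ≈ 1#
  idMat-diagonal n = if-reflects (≡ᵇ-reflects-≡ n n) (λ _ → refl) (λ n≢n → contradiction ≡.refl n≢n)

  idMat-offDiagonal : ∀ {m n} → m ≢ n → idMat m n ≈ 0#
  idMat-offDiagonal {m} {n} m≢n = if-reflects (≡ᵇ-reflects-≡ m n) (λ m≡n → contradiction m≡n m≢n) (λ _ → refl)

  comp-sumTo : ∀ f {ψ} → ψ 0 ≈ 0# → ∀ {n N} → n ≤ N → comp f ψ n ≈ sumTo N (λ j → f j * pow ψ j n)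
  comp-sumTo f ψ0≈0 n≤N =
    sym (sumTo-tail n≤N (λ j n<j _ → trans (*-congˡ (pow-vanish ψ0≈0 n<j)) (zeroʳ _)))

  comp-congˡ : ∀ {f f′} ψ → f ≋ f′ → comp f ψ ≋ comp f′ ψ
  comp-congˡ ψ f≈f′ n = sumTo-cong n (λ j _ → *-congʳ (f≈f′ j))

  comp-0 : ∀ f ψ → comp f ψ 0 ≈ f 0
  comp-0 f ψ = *-identityʳ (f 0)

  comp-one : ∀ ψ → comp one ψ ≋ one
  comp-one ψ n = trans (sumTo-single {n} 0 z≤n (λ j _ j≢0 → trans (*-congʳ (one-≢0 j≢0)) (zeroˡ _)))
                       (*-identityˡ _)

  mul-comp : ∀ f {ψ} → ψ 0 ≈ 0# → ∀ g n → mul (comp f ψ) g n ≈ sumTo n (λ j → f j * mul (pow ψ j) g n)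
  mul-comp f {ψ} ψ0≈0 g n = begin
      mul (comp f ψ) g n
    ≈⟨ mul-cong-≤ n {g = g} (λ m m≤n → comp-sumTo f ψ0≈0 m≤n) (λ _ _ → refl) ⟩
      sumTo n (λ i → sumTo n (λ j → f j * pow ψ j i) * g (n ∸ i))
    ≈⟨ trans (sumTo-cong n (λ i _ → *-distribʳ-sumTo n _ _)) (sumTo-swap n n _) ⟩
      sumTo n (λ j → sumTo n (λ i → f j * pow ψ j i * g (n ∸ i)))
    ≈⟨ sumTo-cong n (λ j _ → mul-scaleˡ (f j) (pow ψ j) g n) ⟩
      sumTo n (λ j → f j * mul (pow ψ j) g n) ∎

  comp-mul : ∀ f g {ψ} → ψ 0 ≈ 0# → comp (mul f g) ψ ≋ mul (comp f ψ) (comp g ψ)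
  comp-mul f g {ψ} ψ0≈0 n = begin
      comp (mul f g) ψ n
    ≈⟨ mul-sumTo n f g (λ m → pow ψ m n) ⟩
      sumTo n (λ i → f i * sumTo (n ∸ i) (λ j → g j * pow ψ (i ℕ.+ j) n))
    ≈⟨ sumTo-cong n (λ i i≤n → *-congˡ (column i≤n)) ⟩
      sumTo n (λ i → f i * mul (pow ψ i) (comp g ψ) n)
    ≈⟨ sym (mul-comp f ψ0≈0 (comp g ψ) n) ⟩
      mul (comp f ψ) (comp g ψ) n ∎
    where
    column : ∀ {i} → i ≤ n → sumTo (n ∸ i) (λ j → g j * pow ψ (i ℕ.+ j) n) ≈ mul (pow ψ i) (comp g ψ) n
    column {i} i≤n = begin
        sumTo (n ∸ i) (λ j → g j * pow ψ (i ℕ.+ j) n)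
      ≈⟨ sym (sumTo-tail (ℕₚ.m∸n≤m n i) (λ j n∸i<j _ → trans (*-congˡ (pow-vanish ψ0≈0 (n<i+j n∸i<j))) (zeroʳ _))) ⟩
        sumTo n (λ j → g j * pow ψ (i ℕ.+ j) n)
      ≈⟨ sumTo-cong n (λ j _ → *-congˡ (trans (pow-+ ψ i j n) (mul-comm (pow ψ i) (pow ψ j) n))) ⟩
        sumTo n (λ j → g j * mul (pow ψ j) (pow ψ i) n)
      ≈⟨ sym (mul-comp g ψ0≈0 (pow ψ i) n) ⟩
        mul (comp g ψ) (pow ψ i) n
      ≈⟨ mul-comm (comp g ψ) (pow ψ i) n ⟩
        mul (pow ψ i) (comp g ψ) n ∎
      where
      n<i+j : ∀ {j} → n ∸ i < j → n < i ℕ.+ j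
      n<i+j {j} n∸i<j = ≡.subst (_< i ℕ.+ j) (ℕₚ.m+[n∸m]≡n i≤n) (ℕₚ.+-monoʳ-< i n∸i<j)

  comp-pow : ∀ f {ψ} → ψ 0 ≈ 0# → ∀ k → comp (pow f k) ψ ≋ pow (comp f ψ) k
  comp-pow f {ψ} ψ0≈0 zero    = comp-one ψ
  comp-pow f {ψ} ψ0≈0 (suc k) n =
    trans (comp-mul (pow f k) f ψ0≈0 n) (mul-congʳ (comp f ψ) (comp-pow f ψ0≈0 k) n)

  X-comp : ∀ {ψ} → ψ 0 ≈ 0# → comp X ψ ≋ ψ
  X-comp ψ0≈0 zero    = trans (zeroˡ _) (sym ψ0≈0)
  X-comp {ψ} ψ0≈0 (suc n) =
    trans (sumTo-single {suc n} 1 (s≤s z≤n) (λ j _ j≢1 → trans (*-congʳ (X-≢1 j≢1)) (zeroˡ _)))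
          (trans (*-identityˡ _) (mul-identityˡ ψ (suc n)))

  comp-X : ∀ f → comp f X ≋ f
  comp-X f n = trans
    (sumTo-single n ℕₚ.≤-refl (λ j _ j≢n → trans (*-congˡ (trans (pow-X j n) (idMat-offDiagonal j≢n))) (zeroʳ _)))
    (trans (*-congˡ (trans (pow-X n n) (idMat-diagonal n))) (*-identityʳ _))

  comp-assoc : ∀ f {φ ψ} → φ 0 ≈ 0# → ψ 0 ≈ 0# → comp (comp f φ) ψ ≋ comp f (comp φ ψ)
  comp-assoc f {φ} {ψ} φ0≈0 ψ0≈0 n = begin
      sumTo n (λ i → comp f φ i * pow ψ i n)
    ≈⟨ sumTo-cong n (λ i i≤n → trans (*-congʳ (comp-sumTo f φ0≈0 i≤n)) (*-distribʳ-sumTo n _ _)) ⟩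
      sumTo n (λ i → sumTo n (λ j → f j * pow φ j i * pow ψ i n))
    ≈⟨ sumTo-swap n n _ ⟩
      sumTo n (λ j → sumTo n (λ i → f j * pow φ j i * pow ψ i n))
    ≈⟨ sumTo-cong n (λ j _ → trans (sumTo-cong n (λ i _ → *-assoc _ _ _)) (sym (*-distribˡ-sumTo n (f j) _))) ⟩
      sumTo n (λ j → f j * comp (pow φ j) ψ n)
    ≈⟨ sumTo-cong n (λ j _ → *-congˡ (comp-pow φ ψ0≈0 j n)) ⟩
      comp f (comp φ ψ) n ∎

  iter-0 : ∀ {ψ} → ψ 0 ≈ 0# → ∀ s → iter ψ s 0 ≈ 0#
  iter-0 ψ0≈0 zero    = refl
  iter-0 {ψ} ψ0≈0 (suc s) = trans (comp-0 (iter ψ s) ψ) (iter-0 ψ0≈0 s)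

  comp-iter : ∀ {ψ} → ψ 0 ≈ 0# → ∀ s → comp ψ (iter ψ s) ≋ iter ψ (suc s)
  comp-iter {ψ} ψ0≈0 zero    n = trans (comp-X ψ n) (sym (X-comp ψ0≈0 n))
  comp-iter {ψ} ψ0≈0 (suc s) n =
    trans (sym (comp-assoc ψ (iter-0 ψ0≈0 s) ψ0≈0 n)) (comp-congˡ ψ (comp-iter ψ0≈0 s) n)

  fromℕ-+ : ∀ m n → fromℕ (m ℕ.+ n) ≈ fromℕ m + fromℕ n
  fromℕ-+ zero    n = sym (+-identityˡ _)
  fromℕ-+ (suc m) n = trans (+-congˡ (fromℕ-+ m n)) (sym (+-assoc _ _ _))

  fromℕ-* : ∀ m n → fromℕ (m ℕ.* n) ≈ fromℕ m * fromℕ n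
  fromℕ-* zero    n = sym (zeroˡ _)
  fromℕ-* (suc m) n = trans (fromℕ-+ n (m ℕ.* n))
    (trans (+-cong (sym (*-identityˡ _)) (fromℕ-* m n)) (sym (distribʳ _ _ _)))

  fromℕ-≉0 : ∀ n → .{{NonZero n}} → ¬ fromℕ n ≈ 0#
  fromℕ-≉0 (suc n) = char0 n

  *-cancelˡ : ∀ {x y z} → ¬ x ≈ 0# → x * y ≈ x * z → y ≈ z
  *-cancelˡ {x} {y} {z} x≉0 xy≈xz = begin
      y                  ≈⟨ sym (trans (*-congʳ (inverseʳ x x≉0)) (*-identityˡ y)) ⟩
      (x * x ⁻¹) * y     ≈⟨ xy∙z≈y∙xz x (x ⁻¹) y ⟩
      x ⁻¹ * (x * y)     ≈⟨ *-congˡ xy≈xz ⟩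
      x ⁻¹ * (x * z)     ≈⟨ sym (xy∙z≈y∙xz x (x ⁻¹) z) ⟩
      (x * x ⁻¹) * z     ≈⟨ trans (*-congʳ (inverseʳ x x≉0)) (*-identityˡ z) ⟩
      z ∎

  tD : PS → PS
  tD f n = fromℕ n * f n

  tD-one : ∀ n → tD one n ≈ 0#
  tD-one zero    = zeroˡ _
  tD-one (suc n) = zeroʳ _

  tD-mul : ∀ f g n → tD (mul f g) n ≈ mul (tD f) g n + mul f (tD g) n
  tD-mul f g n = trans (*-distribˡ-sumTo n (fromℕ n) _) (trans (sumTo-cong n leibniz) (sumTo-+ n _ _))
    where
    leibniz : ∀ i → i ≤ n → fromℕ n * (f i * g (n ∸ i)) ≈ tD f i * g (n ∸ i) + f i * tD g (n ∸ i)
    leibniz i i≤n = begin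
        fromℕ n * (f i * g (n ∸ i))
      ≈⟨ *-congʳ (trans (reflexive (≡.cong fromℕ (≡.sym (ℕₚ.m+[n∸m]≡n i≤n)))) (fromℕ-+ i (n ∸ i))) ⟩
        (fromℕ i + fromℕ (n ∸ i)) * (f i * g (n ∸ i))
      ≈⟨ distribʳ _ _ _ ⟩
        fromℕ i * (f i * g (n ∸ i)) + fromℕ (n ∸ i) * (f i * g (n ∸ i))
      ≈⟨ +-cong (sym (*-assoc _ _ _)) (x∙yz≈y∙xz _ _ _) ⟩
        tD f i * g (n ∸ i) + f i * tD g (n ∸ i) ∎

  tD-pow : ∀ f p n → tD (pow f (suc p)) n ≈ fromℕ (suc p) * mul (tD f) (pow f p) n
  tD-pow f zero n = begin
      fromℕ n * mul one f n ≈⟨ *-congˡ (mul-identityˡ f n) ⟩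
      tD f n                ≈⟨ sym (mul-identityʳ (tD f) n) ⟩
      mul (tD f) one n      ≈⟨ sym (trans (*-congʳ (+-identityʳ 1#)) (*-identityˡ _)) ⟩
      fromℕ 1 * mul (tD f) one n ∎
  tD-pow f (suc p) n = begin
      tD (mul (pow f (suc p)) f) n
    ≈⟨ tD-mul (pow f (suc p)) f n ⟩
      mul (tD (pow f (suc p))) f n + mul (pow f (suc p)) (tD f) n
    ≈⟨ +-cong (mul-congʳ f (tD-pow f p) n) (mul-comm (pow f (suc p)) (tD f) n) ⟩
      mul (λ m → fromℕ (suc p) * mul (tD f) (pow f p) m) f n + y
    ≈⟨ +-congʳ (trans (mul-scaleˡ _ _ f n) (*-congˡ (mul-assoc (tD f) (pow f p) f n))) ⟩
      fromℕ (suc p) * y + y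
    ≈⟨ trans (+-comm _ _) (+-congʳ (sym (*-identityˡ y))) ⟩
      1# * y + fromℕ (suc p) * y
    ≈⟨ sym (distribʳ y 1# (fromℕ (suc p))) ⟩
      fromℕ (suc (suc p)) * y ∎
    where y = mul (tD f) (pow f (suc p)) n

  tD-pow-mul : ∀ f p q n → fromℕ (suc p ℕ.+ q) * mul (tD (pow f (suc p))) (pow f q) n
                           ≈ fromℕ (suc p) * tD (pow f (suc p ℕ.+ q)) n
  tD-pow-mul f p q n = begin
      fromℕ (suc p ℕ.+ q) * mul (tD (pow f (suc p))) (pow f q) n
    ≈⟨ *-congˡ (trans (mul-congʳ (pow f q) (tD-pow f p) n) (mul-scaleˡ _ _ (pow f q) n)) ⟩
      fromℕ (suc p ℕ.+ q) * (fromℕ (suc p) * mul (mul (tD f) (pow f p)) (pow f q) n)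
    ≈⟨ *-congˡ (*-congˡ (trans (mul-assoc (tD f) (pow f p) (pow f q) n)
                               (mul-congˡ (tD f) (λ m → sym (pow-+ f p q m)) n))) ⟩
      fromℕ (suc p ℕ.+ q) * (fromℕ (suc p) * y)
    ≈⟨ x∙yz≈y∙xz _ _ _ ⟩
      fromℕ (suc p) * (fromℕ (suc p ℕ.+ q) * y)
    ≈⟨ *-congˡ (sym (tD-pow f (p ℕ.+ q) n)) ⟩
      fromℕ (suc p) * tD (pow f (suc p ℕ.+ q)) n ∎
    where y = mul (tD f) (pow f (p ℕ.+ q)) n

  module LagrangeInversion (h ω : PS) (ω0≈0 : ω 0 ≈ 0#) (ω-fixpoint : ω ≋ mul X (comp h ω)) where

    pow-ω : ∀ m r → pow ω m (m ℕ.+ r) ≈ comp (pow h m) ω r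
    pow-ω m r = begin
        pow ω m (m ℕ.+ r)
      ≈⟨ pow-cong ω-fixpoint m (m ℕ.+ r) ⟩
        pow (mul X (comp h ω)) m (m ℕ.+ r)
      ≈⟨ pow-mul X (comp h ω) m (m ℕ.+ r) ⟩
        mul (pow X m) (pow (comp h ω) m) (m ℕ.+ r)
      ≈⟨ mul-pow-X m r (pow (comp h ω) m) ⟩
        pow (comp h ω) m r
      ≈⟨ sym (comp-pow h ω0≈0 m r) ⟩
        comp (pow h m) ω r ∎

    LagrangeAt : ℕ → Set ℓ
    LagrangeAt n = ∀ m → m ≤ n → fromℕ n * pow ω m n ≈ fromℕ m * pow h n (n ∸ m)

    lagrange-step : ∀ m r → LagrangeAt r →
      fromℕ r * (fromℕ (suc m ℕ.+ r) * pow ω (suc m) (suc m ℕ.+ r))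
      ≈ fromℕ r * (fromℕ (suc m) * pow h (suc m ℕ.+ r) r)
    lagrange-step m r IH = begin
        fromℕ r * (fromℕ n * pow ω (suc m) n)
      ≈⟨ x∙yz≈y∙xz _ _ _ ⟩
        fromℕ n * (fromℕ r * pow ω (suc m) n)
      ≈⟨ *-congˡ (trans (*-congˡ (pow-ω (suc m) r)) (*-distribˡ-sumTo r (fromℕ r) _)) ⟩
        fromℕ n * sumTo r (λ j → fromℕ r * (pow h (suc m) j * pow ω j r))
      ≈⟨ *-congˡ (sumTo-cong r term) ⟩
        fromℕ n * mul (tD (pow h (suc m))) (pow h r) r
      ≈⟨ tD-pow-mul h m r r ⟩
        fromℕ (suc m) * (fromℕ r * pow h n r)
      ≈⟨ x∙yz≈y∙xz _ _ _ ⟩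
        fromℕ r * (fromℕ (suc m) * pow h n r) ∎
      where
      n = suc m ℕ.+ r
      term : ∀ j → j ≤ r → fromℕ r * (pow h (suc m) j * pow ω j r) ≈ tD (pow h (suc m)) j * pow h r (r ∸ j)
      term j j≤r = trans (x∙yz≈y∙xz _ _ _) (trans (*-congˡ (IH j j≤r)) (x∙yz≈yx∙z _ _ _))

    lagrange-+ : ∀ m r → (∀ {r′} → r′ < suc m ℕ.+ r → LagrangeAt r′) →
                 fromℕ (suc m ℕ.+ r) * pow ω (suc m) (suc m ℕ.+ r) ≈ fromℕ (suc m) * pow h (suc m ℕ.+ r) r
    lagrange-+ m zero    _  = trans (*-congˡ (trans (pow-ω (suc m) 0) (comp-0 (pow h (suc m)) ω)))
      (*-cong (reflexive (≡.cong fromℕ m+0≡m)) (reflexive (≡.cong (λ k → pow h k 0) (≡.sym m+0≡m))))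
      where m+0≡m = ℕₚ.+-identityʳ (suc m)
    lagrange-+ m (suc r) IH =
      *-cancelˡ (fromℕ-≉0 (suc r)) (lagrange-step m (suc r) (IH (ℕₚ.m<n+m (suc r) (s≤s z≤n))))

    lagrange : ∀ n → LagrangeAt n
    lagrange = <-rec LagrangeAt step
      where
      step : ∀ n → (∀ {r} → r < n → LagrangeAt r) → LagrangeAt n
      step n _  zero _ = trans (tD-one n) (sym (zeroˡ _))
      step n IH (suc m) m<n with ℕₚ.m≤n⇒∃[o]m+o≡n m<n
      ... | r , ≡.refl = trans (lagrange-+ m r IH)
        (*-congˡ (reflexive (≡.cong (pow h (suc m ℕ.+ r)) (≡.sym (ℕₚ.m+n∸m≡n (suc m) r)))))

    lagrange-bürmann : ∀ g n → fromℕ (suc n) * comp g ω (suc n) ≈ mul (pow h (suc n)) (deriv g) n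
    lagrange-bürmann g n = begin
        fromℕ (suc n) * comp g ω (suc n)
      ≈⟨ *-distribˡ-sumTo (suc n) _ _ ⟩
        sumTo (suc n) (λ m → fromℕ (suc n) * (g m * pow ω m (suc n)))
      ≈⟨ sumTo-cong (suc n) (λ m m≤1+n → trans (x∙yz≈y∙xz _ _ _) (*-congˡ (lagrange (suc n) m m≤1+n))) ⟩
        sumTo (suc n) (λ m → g m * (fromℕ m * pow h (suc n) (suc n ∸ m)))
      ≈⟨ sumTo-head n _ ⟩
        g 0 * (0# * pow h (suc n) (suc n)) + sumTo n (λ m → g (suc m) * (fromℕ (suc m) * pow h (suc n) (n ∸ m)))
      ≈⟨ +-cong (trans (*-congˡ (zeroˡ _)) (zeroʳ _)) (sumTo-cong n (λ m _ → x∙yz≈yx∙z _ _ _)) ⟩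
        0# + mul (deriv g) (pow h (suc n)) n
      ≈⟨ trans (+-identityˡ _) (mul-comm (deriv g) (pow h (suc n)) n) ⟩
        mul (pow h (suc n)) (deriv g) n ∎

  module _ (a : ℕ → Carrier) (a≉0 : ∀ j → 1 ≤ j → ¬ a j ≈ 0#) where
    open import Algebra.Solver.Ring.NaturalCoefficients.Default commutativeSemiring

    prefactor : ℕ → ℕ → Carrier
    prefactor k n = a k * (a n) ⁻¹ * (fromℕ (k !)) ⁻¹

    prefactor-diagonal : ∀ k → 1 ≤ k → prefactor k k * (fromℕ (k !) * 1#) ≈ 1#
    prefactor-diagonal k 1≤k = begin
        a k * a k ⁻¹ * fromℕ (k !) ⁻¹ * (fromℕ (k !) * 1#)
      ≈⟨ shuffle (a k) (a k ⁻¹) (fromℕ (k !)) (fromℕ (k !) ⁻¹) ⟩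
        (a k * a k ⁻¹) * (fromℕ (k !) * fromℕ (k !) ⁻¹)
      ≈⟨ *-cong (inverseʳ (a k) (a≉0 k 1≤k)) (inverseʳ _ (fromℕ-≉0 (k !) {{k ℕₚ.!≢0}})) ⟩
        1# * 1#
      ≈⟨ *-identityˡ 1# ⟩
        1# ∎
      where
      shuffle : ∀ x x′ y y′ → x * x′ * y′ * (y * 1#) ≈ (x * x′) * (y * y′)
      shuffle = solve 4 (λ x x′ y y′ → x :* x′ :* y′ :* (y :* con 1) := (x :* x′) :* (y :* y′)) refl

    prefactor-chain : ∀ k j n x y → 1 ≤ j →
      (prefactor k j * (fromℕ (j !) * x)) * (prefactor j n * (fromℕ (n !) * y))
      ≈ prefactor k n * (fromℕ (n !) * (x * y))
    prefactor-chain k j n x y 1≤j = begin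
        (a k * a j ⁻¹ * fromℕ (k !) ⁻¹ * (fromℕ (j !) * x)) * (a j * a n ⁻¹ * fromℕ (j !) ⁻¹ * (fromℕ (n !) * y))
      ≈⟨ shuffle (a k) (a j ⁻¹) (fromℕ (k !) ⁻¹) (fromℕ (j !)) x (a j) (a n ⁻¹) (fromℕ (j !) ⁻¹) (fromℕ (n !)) y ⟩
        prefactor k n * (fromℕ (n !) * (x * y)) * ((a j * a j ⁻¹) * (fromℕ (j !) * fromℕ (j !) ⁻¹))
      ≈⟨ *-congˡ (trans (*-cong (inverseʳ (a j) (a≉0 j 1≤j)) (inverseʳ _ (fromℕ-≉0 (j !) {{j ℕₚ.!≢0}})))
                        (*-identityˡ 1#)) ⟩
        prefactor k n * (fromℕ (n !) * (x * y)) * 1#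
      ≈⟨ *-identityʳ _ ⟩
        prefactor k n * (fromℕ (n !) * (x * y)) ∎
      where
      shuffle : ∀ ak aj′ kf′ jf x aj an′ jf′ nf y →
        (ak * aj′ * kf′ * (jf * x)) * (aj * an′ * jf′ * (nf * y))
        ≈ ak * an′ * kf′ * (nf * (x * y)) * ((aj * aj′) * (jf * jf′))
      shuffle = solve 10 (λ ak aj′ kf′ jf x aj an′ jf′ nf y →
        (ak :* aj′ :* kf′ :* (jf :* x)) :* (aj :* an′ :* jf′ :* (nf :* y))
        := ak :* an′ :* kf′ :* (nf :* (x :* y)) :* ((aj :* aj′) :* (jf :* jf′))) refl

    idMat-prefactor : ∀ k n → 1 ≤ k → idMat k n ≈ prefactor k n * (fromℕ (n !) * idMat k n)
    idMat-prefactor k n 1≤k with k ℕ.≟ n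
    ... | yes ≡.refl = trans (idMat-diagonal k)
      (sym (trans (*-congˡ (*-congˡ (idMat-diagonal k))) (prefactor-diagonal k 1≤k)))
    ... | no  k≢n    = trans (idMat-offDiagonal k≢n)
      (sym (trans (*-congˡ (trans (*-congˡ (idMat-offDiagonal k≢n)) (zeroʳ _))) (zeroʳ _)))

    module _ (φ g h : PS) (φ0≈0 : φ 0 ≈ 0#)
             (ω : PS) (ω0≈0 : ω 0 ≈ 0#) (ω-fixpoint : ω ≋ mul X (comp h ω)) where
      open LagrangeInversion h ω ω0≈0 ω-fixpoint

      ψ : PS
      ψ = comp φ ω

      ψ0≈0 : ψ 0 ≈ 0#
      ψ0≈0 = trans (comp-0 φ ω) φ0≈0

      𝒜-entry : ∀ k n → 1 ≤ n → 𝒜 a φ g h k n ≈ prefactor k n * dAt n (mul (pow ψ k) (comp g ω))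
      𝒜-entry k (suc n) _ =
        if-reflects (ℕₚ.≤ᵇ-reflects-≤ k (suc n)) (λ _ → *-congˡ on-or-above-diagonal) below-diagonal
        where
        on-or-above-diagonal :
          dAt n (mul (pow h (suc n)) (deriv (mul (pow φ k) g))) ≈ dAt (suc n) (mul (pow ψ k) (comp g ω))
        on-or-above-diagonal = begin
            fromℕ (n !) * mul (pow h (suc n)) (deriv (mul (pow φ k) g)) n
          ≈⟨ *-congˡ (sym (lagrange-bürmann (mul (pow φ k) g) n)) ⟩
            fromℕ (n !) * (fromℕ (suc n) * comp (mul (pow φ k) g) ω (suc n))
          ≈⟨ trans (x∙yz≈yx∙z _ _ _) (*-congʳ (sym (fromℕ-* (suc n) (n !)))) ⟩
            fromℕ (suc n !) * comp (mul (pow φ k) g) ω (suc n)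
          ≈⟨ *-congˡ (trans (comp-mul (pow φ k) g ω0≈0 (suc n))
                            (mul-congʳ (comp g ω) (comp-pow φ ω0≈0 k) (suc n))) ⟩
            fromℕ (suc n !) * mul (pow ψ k) (comp g ω) (suc n) ∎
        below-diagonal : ¬ k ≤ suc n → 0# ≈ prefactor k (suc n) * dAt (suc n) (mul (pow ψ k) (comp g ω))
        below-diagonal k≰1+n = sym (trans (*-congˡ (trans (*-congˡ
          (mul-vanish (suc n) (pow ψ k) (comp g ω) (λ i i≤1+n →
            pow-vanish ψ0≈0 (ℕₚ.≤-<-trans i≤1+n (ℕₚ.≰⇒> k≰1+n))))) (zeroʳ _))) (zeroʳ _))

      G : ℕ → PS
      G i = comp g (comp ω (iter ψ i))

      comp-iter-mul : ∀ k s → comp (mul (pow ψ k) (comp g ω)) (iter ψ s) ≋ mul (pow (iter ψ (suc s)) k) (G s)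
      comp-iter-mul k s n = trans (comp-mul (pow ψ k) (comp g ω) (iter-0 ψ0≈0 s) n)
        (mul-cong (λ m → trans (comp-pow ψ (iter-0 ψ0≈0 s) k m) (pow-cong (comp-iter ψ0≈0 s) k m))
                  (comp-assoc g ω0≈0 (iter-0 ψ0≈0 s)) n)

      matPow-𝒜 : ∀ s k n → 1 ≤ k → 1 ≤ n →
        matPow (𝒜 a φ g h) s k n ≈ prefactor k n * dAt n (mul (pow (iter ψ s) k) (prodS s G))
      matPow-𝒜 zero k n 1≤k _ = trans (idMat-prefactor k n 1≤k)
        (*-congˡ (*-congˡ (sym (trans (mul-identityʳ (pow X k) n) (pow-X k n)))))
      matPow-𝒜 (suc s) k n 1≤k 1≤n = begin
          sum1To n (λ j → 𝒜 a φ g h k j * matPow (𝒜 a φ g h) s j n)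
        ≈⟨ sum1To-cong n (λ j 1≤j _ → trans (*-cong (𝒜-entry k j 1≤j) (matPow-𝒜 s j n 1≤j 1≤n))
                                            (prefactor-chain k j n _ _ 1≤j)) ⟩
          sum1To n (λ j → prefactor k n * (fromℕ (n !) * term j))
        ≈⟨ sym (trans (*-congˡ (*-distribˡ-sum1To n _ term)) (*-distribˡ-sum1To n _ _)) ⟩
          prefactor k n * (fromℕ (n !) * sum1To n term)
        ≈⟨ *-congˡ (*-congˡ sum-terms) ⟩
          prefactor k n * dAt n (mul (pow (iter ψ (suc s)) k) (prodS (suc s) G)) ∎
        where
        C = mul (pow ψ k) (comp g ω)
        term : ℕ → Carrier
        term j = C j * mul (pow (iter ψ s) j) (prodS s G) n
        sum-terms : sum1To n term ≈ mul (pow (iter ψ (suc s)) k) (prodS (suc s) G) n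
        sum-terms = begin
            sum1To n term
          ≈⟨ sym (trans (sumTo-sum1To n term) (trans (+-congʳ term0≈0) (+-identityˡ _))) ⟩
            sumTo n term
          ≈⟨ sym (mul-comp C (iter-0 ψ0≈0 s) (prodS s G) n) ⟩
            mul (comp C (iter ψ s)) (prodS s G) n
          ≈⟨ mul-congʳ (prodS s G) (comp-iter-mul k s) n ⟩
            mul (mul (pow (iter ψ (suc s)) k) (G s)) (prodS s G) n
          ≈⟨ trans (mul-assoc _ (G s) (prodS s G) n) (mul-congˡ _ (mul-comm (G s) (prodS s G)) n) ⟩
            mul (pow (iter ψ (suc s)) k) (prodS (suc s) G) n ∎
          where
          term0≈0 : term 0 ≈ 0#
          term0≈0 = trans (*-congʳ (mul-vanish 0 (pow ψ k) (comp g ω) (λ { 0 z≤n → pow-vanish ψ0≈0 1≤k }))) (zeroˡ _)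

theorem2 : ∀ {c ℓ : Level} (F : Char0Field c ℓ) →
    let open Char0Field F
        open Series F
    in (a : ℕ → Carrier) → (∀ j → 1 ≤ j → ¬ (a j ≈ 0#)) →
       (φ g h : PS) → φ 0 ≈ 0# → ¬ ((φ 1 * g 0) * h 0 ≈ 0#) →
       (ω : PS) → ω 0 ≈ 0# → (∀ m → ω m ≈ mul X (comp h ω) m) →
       ∀ (s k n : ℕ) → 1 ≤ k → 1 ≤ n →
       matPow (𝒜 a φ g h) s k n
         ≈ a k * (a n) ⁻¹ * (fromℕ (k !)) ⁻¹
             * dAt n (mul (pow (iter (comp φ ω) s) k)
                          (prodS s (λ i → comp g (comp ω (iter (comp φ ω) i)))))
theorem2 F a a≉0 φ g h φ0≈0 _ ω ω0≈0 ω-fixpoint = matPow-𝒜 F a a≉0 φ g h φ0≈0 ω ω0≈0 ω-fixpoint
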